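{- Let $\mathcal{G}$ and $\mathcal{H}$ be two hypergraphs on vertex set $V$ satisfying the intersection property, and let $\sigma$ be an assignment. Then $\mathcal{G}(\sigma)$ and $\mathcal{H}(\sigma)$ satisfy the intersection property.
   Context: Hypergraphs are identified with their edge sets. Intersection property: every edge of the first hypergraph meets every edge of the second (vacuously true if one is empty). An assignment is a pair $\sigma=\langle\mathrm{In},\mathrm{Ex}\rangle$ of disjoint subsets of $V$. For $S\subseteq V$: $\mathcal{G}_S=\{G\in\mathcal{G}:G\subseteq S\}$, $\mathcal{G}^S=\min(\{G\cap S:G\in\mathcal{G}\})$ ($\min$ keeps inclusion-minimal sets). $\mathcal{G}(\sigma)=(\mathcal{G}_{V\setminus\mathrm{In}})^{V\setminus(\mathrm{In}\cup\mathrm{Ex})}$, $\mathcal{H}(\sigma)=(\mathcal{H}_{V\setminus\mathrm{Ex}})^{V\setminus(\mathrm{In}\cup\mathrm{Ex})}$; these may be empty or equal to $\{\emptyset\}$. -}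

module Defs where

open import Data.Nat using (ℕ)
open import Data.Product using (Σ; ∃; _×_)
open import Data.Fin.Subset using (Subset; _⊆_; _∩_; _∪_; ∁; Nonempty; Empty)
open import Relation.Binary.PropositionalEquality using (_≡_)

-- A hypergraph on the vertex set V = Fin n, identified with its edge set:
-- a (necessarily finite) set of subsets of V, given as a predicate.
Hypergraph : ℕ → Set₁
Hypergraph n = Subset n → Set

Intersecting : ∀ {n} → Hypergraph n → Hypergraph n → Set
Intersecting G H = ∀ A B → G A → H B → Nonempty (A ∩ B)

minimal : ∀ {n} → Hypergraph n → Hypergraph n
minimal F A = F A × (∀ B → F B → B ⊆ A → B ≡ A)

-- G_S = { G ∈ G : G ⊆ S }
restrict : ∀ {n} → Hypergraph n → Subset n → Hypergraph n
restrict G S A = G A × A ⊆ S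

-- G^S = min { G ∩ S : G ∈ G }
project : ∀ {n} → Hypergraph n → Subset n → Hypergraph n
project G S = minimal (λ A → ∃ λ E → G E × A ≡ E ∩ S)

record Assignment (n : ℕ) : Set where
  field
    In       : Subset n
    Ex       : Subset n
    disjoint : Empty (In ∩ Ex)
open Assignment public

-- G(σ) = (G_{V∖In})^{V∖(In∪Ex)}
reduceG : ∀ {n} → Hypergraph n → Assignment n → Hypergraph n
reduceG G σ = project (restrict G (∁ (In σ))) (∁ (In σ ∪ Ex σ))

-- H(σ) = (H_{V∖Ex})^{V∖(In∪Ex)}
reduceH : ∀ {n} → Hypergraph n → Assignment n → Hypergraph n
reduceH H σ = project (restrict H (∁ (Ex σ))) (∁ (In σ ∪ Ex σ))

-- If E ∈ G avoids In and F ∈ H avoids Ex, a common vertex of E and F avoids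
-- In ∪ Ex, so it survives in both projections E ∖ (In ∪ Ex) and F ∖ (In ∪ Ex).
module Submission where

open import Data.Nat using (ℕ)
open import Data.Fin using (Fin)
open import Data.Fin.Subset using (Subset; _∈_; _∩_; _∪_; ∁; Nonempty)
open import Data.Fin.Subset.Properties
  using (x∈p∩q⁺; x∈p∩q⁻; x∈p∪q⁻; x∈∁p⇒x∉p; x∉p⇒x∈∁p)
open import Data.Product using (_,_)
open import Data.Sum using ([_,_]′)
open import Function using (_∘′_)
open import Relation.Binary.PropositionalEquality using (subst; sym)

open import Defs

module _ {n : ℕ} where

  x∈∁p⇒x∈∁q⇒x∈∁[p∪q] : ∀ {x : Fin n} {p q : Subset n} →
    x ∈ ∁ p → x ∈ ∁ q → x ∈ ∁ (p ∪ q)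
  x∈∁p⇒x∈∁q⇒x∈∁[p∪q] {p = p} {q} x∈∁p x∈∁q =
    x∉p⇒x∈∁p ([ x∈∁p⇒x∉p x∈∁p , x∈∁p⇒x∉p x∈∁q ]′ ∘′ x∈p∪q⁻ p q)

  IntersectingWithin : Subset n → Hypergraph n → Hypergraph n → Set
  IntersectingWithin S G H = ∀ A B → G A → H B → Nonempty (A ∩ B ∩ S)

  restrict-intersectingWithin : ∀ {G H : Hypergraph n} (P Q : Subset n) →
    Intersecting G H → IntersectingWithin (∁ (P ∪ Q)) (restrict G (∁ P)) (restrict H (∁ Q))
  restrict-intersectingWithin P Q int E F (GE , E⊆∁P) (HF , F⊆∁Q)
    with int E F GE HF
  ... | x , x∈E∩F with x∈p∩q⁻ E F x∈E∩F
  ... | x∈E , x∈F =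
    x , x∈p∩q⁺ (x∈E , x∈p∩q⁺ (x∈F , x∈∁p⇒x∈∁q⇒x∈∁[p∪q] (E⊆∁P x∈E) (F⊆∁Q x∈F)))

  project-intersecting : ∀ {G H : Hypergraph n} (S : Subset n) →
    IntersectingWithin S G H → Intersecting (project G S) (project H S)
  project-intersecting S int A B ((E , GE , A≡E∩S) , _) ((F , HF , B≡F∩S) , _)
    with int E F GE HF
  ... | x , x∈E∩F∩S with x∈p∩q⁻ E (F ∩ S) x∈E∩F∩S
  ... | x∈E , x∈F∩S with x∈p∩q⁻ F S x∈F∩S
  ... | x∈F , x∈S = x , x∈p∩q⁺ (x∈A , x∈B)
    where
    x∈A : x ∈ A
    x∈A = subst (x ∈_) (sym A≡E∩S) (x∈p∩q⁺ (x∈E , x∈S))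
    x∈B : x ∈ B
    x∈B = subst (x ∈_) (sym B≡F∩S) (x∈p∩q⁺ (x∈F , x∈S))

lemma20 : ∀ (n : ℕ) (G H : Hypergraph n) (σ : Assignment n) →
    Intersecting G H → Intersecting (reduceG G σ) (reduceH H σ)
lemma20 n G H σ int =
  project-intersecting (∁ (In σ ∪ Ex σ))
    (restrict-intersectingWithin (In σ) (Ex σ) int)
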